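{- The $S_5$ axiom scheme $\mathsf{5}:\ \Diamond A\to\Box\Diamond A$ is not in general realizable in $\mathcal{V}^\omega$ under the modal Dialectica translation (nor under the light modal Dialectica translation): there are formulas $A$ for which the instance $\Diamond A\to\Box\Diamond A$ is not realizable.
   Context: Finite types: $\rho,\sigma ::= \mathbb{N}\mid\mathbb{B}\mid(\rho\sigma)$. Terms are those of Gödel's System T (variables, $\mathrm{true},\mathrm{false},0,S,\mathrm{If},\mathrm{Rec}$, $\lambda$-abstraction, application). Atomic formulas are $\mathrm{at}(t)$ for boolean terms $t$; $\bot:=\mathrm{at}(\mathrm{false})$, $\neg A:=A\to\bot$. The verifying system $\mathcal{V}^\omega$ is classical arithmetic in all finite types in natural deduction form, with formulas built from atoms by $\to,\wedge,\forall$ ($\exists x A:=\neg\forall x\neg A$), induction for booleans and naturals, extensional equality at higher types and the full compatibility (extensionality) axiom; stability $\neg\neg A\to A$ is provable. The modal language: formulas $A ::= \mathrm{at}(t)\mid A\to B\mid A\wedge B\mid\forall x^\rho A\mid\Box A$, with $\Diamond A:=\neg\Box\neg A$; the light modal language additionally has quantifiers $\forall^{+},\forall^{ - },\forall^{nc}$. Modal Dialectica translation: $|A|^{\underline x}_{\underline y}$ ($\underline x$ witness, $\underline y$ challenge tuples of fresh variables) defined by $|\mathrm{at}(t)|:=\mathrm{at}(t)$; $|A\wedge B|^{\underline x,\underline u}_{\underline y,\underline v}:=|A|^{\underline x}_{\underline y}\wedge|B|^{\underline u}_{\underline v}$; $|A\to B|^{\underline f,\underline g}_{\underline x,\underline v}:=|A|^{\underline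 x}_{\underline f\underline x\underline v}\to|B|^{\underline g\underline x}_{\underline v}$; $|\forall zA(z)|^{\underline f}_{z,\underline y}:=|A(z)|^{\underline fz}_{\underline y}$; $|\Box A|^{\underline x}:=\forall\underline y\,|A|^{\underline x}_{\underline y}$. Hence $|\Diamond A|_{\underline f}\equiv\exists\underline x\,|A|^{\underline x}_{\underline f\underline x}$. The light variant adds $|\forall^{+}zA(z)|^{\underline f}_{\underline y}:=\forall z|A(z)|^{\underline fz}_{\underline y}$, $|\forall^{ - }zA(z)|^{\underline x}_{z,\underline y}:=|A(z)|^{\underline x}_{\underline y}$, $|\forall^{nc}zA(z)|^{\underline x}_{\underline y}:=\forall z|A(z)|^{\underline x}_{\underline y}$. A formula $C$ with free variables $\underline w$ is realizable in $\mathcal{V}^\omega$ if there is a tuple of terms $\underline t$ with $\mathrm{FV}(\underline t)\subseteq\{\underline w\}$ such that $\mathcal{V}^\omega\vdash\forall\underline y\,|C|^{\underline t}_{\underline y}$. -}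

module Defs where

open import Data.List using (List; []; _∷_; _++_; map)
open import Data.List.Membership.Propositional using (_∈_)
open import Data.List.Relation.Unary.All using (All; []; _∷_)
open import Data.Product using (Σ; _×_; _,_)
open import Data.Unit using (⊤)
open import Data.Empty using (⊥)
open import Function using (_∘_; id)

data Ty : Set where
  N B : Ty
  _⇒_ : Ty → Ty → Ty
infixr 7 _⇒_

Ctx : Set
Ctx = List Ty

data _∋_ : Ctx → Ty → Set where
  here  : ∀ {Γ ρ} → (ρ ∷ Γ) ∋ ρ
  there : ∀ {Γ ρ σ} → Γ ∋ ρ → (σ ∷ Γ) ∋ ρ

infixl 9 _·_
data Tm (Γ : Ctx) : Ty → Set where
  var   : ∀ {ρ} → Γ ∋ ρ → Tm Γ ρ
  true  : Tm Γ B
  false : Tm Γ B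
  zero  : Tm Γ N
  S     : Tm Γ (N ⇒ N)
  If    : ∀ {ρ} → Tm Γ (B ⇒ ρ ⇒ ρ ⇒ ρ)
  Rec   : ∀ {ρ} → Tm Γ (N ⇒ ρ ⇒ (N ⇒ ρ ⇒ ρ) ⇒ ρ)
  lam   : ∀ {ρ σ} → Tm (ρ ∷ Γ) σ → Tm Γ (ρ ⇒ σ)
  _·_   : ∀ {ρ σ} → Tm Γ (ρ ⇒ σ) → Tm Γ ρ → Tm Γ σ

Ren : Ctx → Ctx → Set
Ren Γ Δ = ∀ {ρ} → Γ ∋ ρ → Δ ∋ ρ

Sub : Ctx → Ctx → Set
Sub Γ Δ = ∀ {ρ} → Γ ∋ ρ → Tm Δ ρ

extR : ∀ {Γ Δ σ} → Ren Γ Δ → Ren (σ ∷ Γ) (σ ∷ Δ)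
extR r here      = here
extR r (there x) = there (r x)

ren : ∀ {Γ Δ ρ} → Ren Γ Δ → Tm Γ ρ → Tm Δ ρ
ren r (var x) = var (r x)
ren r true    = true
ren r false   = false
ren r zero    = zero
ren r S       = S
ren r If      = If
ren r Rec     = Rec
ren r (lam t) = lam (ren (extR r) t)
ren r (t · u) = ren r t · ren r u

wk : ∀ {Γ ρ σ} → Tm Γ ρ → Tm (σ ∷ Γ) ρ
wk = ren there

extS : ∀ {Γ Δ σ} → Sub Γ Δ → Sub (σ ∷ Γ) (σ ∷ Δ)
extS s here      = var here
extS s (there x) = wk (s x)

sub : ∀ {Γ Δ ρ} → Sub Γ Δ → Tm Γ ρ → Tm Δ ρ
sub s (var x) = s x
sub s true    = true
sub s false   = false
sub s zero    = zero
sub s S       = S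
sub s If      = If
sub s Rec     = Rec
sub s (lam t) = lam (sub (extS s) t)
sub s (t · u) = sub s t · sub s u

_,ₛ_ : ∀ {Γ Δ ρ} → Sub Γ Δ → Tm Δ ρ → Sub (ρ ∷ Γ) Δ
(s ,ₛ t) here      = t
(s ,ₛ t) (there x) = s x

sub0 : ∀ {Γ ρ} → Tm Γ ρ → Sub (ρ ∷ Γ) Γ
sub0 t = var ,ₛ t

infix 4 _≈_
data _≈_ {Γ : Ctx} : ∀ {ρ} → Tm Γ ρ → Tm Γ ρ → Set where
  ≈refl  : ∀ {ρ} {t : Tm Γ ρ} → t ≈ t
  ≈sym   : ∀ {ρ} {s t : Tm Γ ρ} → s ≈ t → t ≈ s
  ≈trans : ∀ {ρ} {s t u : Tm Γ ρ} → s ≈ t → t ≈ u → s ≈ u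
  ≈app   : ∀ {ρ σ} {f g : Tm Γ (ρ ⇒ σ)} {s t : Tm Γ ρ} → f ≈ g → s ≈ t → f · s ≈ g · t
  ≈lam   : ∀ {ρ σ} {s t : Tm (ρ ∷ Γ) σ} → _≈_ {ρ ∷ Γ} s t → lam s ≈ lam t
  ≈β     : ∀ {ρ σ} (r : Tm (ρ ∷ Γ) σ) (s : Tm Γ ρ) → lam r · s ≈ sub (sub0 s) r
  ≈η     : ∀ {ρ σ} (t : Tm Γ (ρ ⇒ σ)) → lam (wk t · var here) ≈ t
  ≈ifT   : ∀ {ρ} (r s : Tm Γ ρ) → If · true · r · s ≈ r
  ≈ifF   : ∀ {ρ} (r s : Tm Γ ρ) → If · false · r · s ≈ s
  ≈rec0  : ∀ {ρ} (r : Tm Γ ρ) (s : Tm Γ (N ⇒ ρ ⇒ ρ)) → Rec · zero · r · s ≈ r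
  ≈recS  : ∀ {ρ} (n : Tm Γ N) (r : Tm Γ ρ) (s : Tm Γ (N ⇒ ρ ⇒ ρ)) →
           Rec · (S · n) · r · s ≈ s · n · (Rec · n · r · s)

infixr 5 _⊃_
infixr 6 _∧_
data Fm (Γ : Ctx) : Set where
  at   : Tm Γ B → Fm Γ
  _⊃_  : Fm Γ → Fm Γ → Fm Γ
  _∧_  : Fm Γ → Fm Γ → Fm Γ
  ∀'   : (ρ : Ty) → Fm (ρ ∷ Γ) → Fm Γ

subF : ∀ {Γ Δ} → Sub Γ Δ → Fm Γ → Fm Δ
subF s (at t)   = at (sub s t)
subF s (A ⊃ B′) = subF s A ⊃ subF s B′
subF s (A ∧ B′) = subF s A ∧ subF s B′
subF s (∀' ρ A) = ∀' ρ (subF (extS s) A)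

wkF : ∀ {Γ σ} → Fm Γ → Fm (σ ∷ Γ)
wkF = subF (var ∘ there)

_[_] : ∀ {Γ ρ} → Fm (ρ ∷ Γ) → Tm Γ ρ → Fm Γ
A [ t ] = subF (sub0 t) A

⊥F : ∀ {Γ} → Fm Γ
⊥F = at false

¬F : ∀ {Γ} → Fm Γ → Fm Γ
¬F A = A ⊃ ⊥F

data _≈F_ {Γ : Ctx} : Fm Γ → Fm Γ → Set where
  at≈ : ∀ {s t} → s ≈ t → at s ≈F at t
  ⊃≈  : ∀ {A A′ C C′} → A ≈F A′ → C ≈F C′ → (A ⊃ C) ≈F (A′ ⊃ C′)
  ∧≈  : ∀ {A A′ C C′} → A ≈F A′ → C ≈F C′ → (A ∧ C) ≈F (A′ ∧ C′)
  ∀≈  : ∀ {ρ} {A A′ : Fm (ρ ∷ Γ)} → _≈F_ {ρ ∷ Γ} A A′ → ∀' ρ A ≈F ∀' ρ A′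

eqB : ∀ {Γ} → Tm Γ (B ⇒ B ⇒ B)
eqB = lam (lam (If · var (there here) · var here · (If · var here · false · true)))

eqN : ∀ {Γ} → Tm Γ (N ⇒ N ⇒ B)
eqN = lam (Rec · var here · z0 · step)
  where
  z0 : ∀ {Δ} → Tm Δ (N ⇒ B)
  z0 = lam (Rec · var here · true · lam (lam false))
  step : ∀ {Δ} → Tm Δ (N ⇒ (N ⇒ B) ⇒ (N ⇒ B))
  step = lam (lam (lam (Rec · var here · false
           · lam (lam (var (there (there (there here))) · var (there here))))))

Eq : ∀ {Γ} (ρ : Ty) → Tm Γ ρ → Tm Γ ρ → Fm Γ
Eq N s t       = at (eqN · s · t)
Eq B s t       = at (eqB · s · t)
Eq (ρ ⇒ σ) s t = ∀' ρ (Eq σ (wk s · var here) (wk t · var here))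

succSub : ∀ {Γ} → Sub (N ∷ Γ) (N ∷ Γ)
succSub here      = S · var here
succSub (there x) = var (there x)

infix 3 _⨾_⊢_
data _⨾_⊢_ : (Γ : Ctx) → List (Fm Γ) → Fm Γ → Set where
  hyp   : ∀ {Γ Δ A} → A ∈ Δ → Γ ⨾ Δ ⊢ A
  ⊃I    : ∀ {Γ Δ A C} → Γ ⨾ (A ∷ Δ) ⊢ C → Γ ⨾ Δ ⊢ A ⊃ C
  ⊃E    : ∀ {Γ Δ A C} → Γ ⨾ Δ ⊢ A ⊃ C → Γ ⨾ Δ ⊢ A → Γ ⨾ Δ ⊢ C
  ∧I    : ∀ {Γ Δ A C} → Γ ⨾ Δ ⊢ A → Γ ⨾ Δ ⊢ C → Γ ⨾ Δ ⊢ A ∧ C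
  ∧E₁   : ∀ {Γ Δ A C} → Γ ⨾ Δ ⊢ A ∧ C → Γ ⨾ Δ ⊢ A
  ∧E₂   : ∀ {Γ Δ A C} → Γ ⨾ Δ ⊢ A ∧ C → Γ ⨾ Δ ⊢ C
  ∀I    : ∀ {Γ Δ ρ A} → (ρ ∷ Γ) ⨾ map wkF Δ ⊢ A → Γ ⨾ Δ ⊢ ∀' ρ A
  ∀E    : ∀ {Γ Δ ρ A} → Γ ⨾ Δ ⊢ ∀' ρ A → (t : Tm Γ ρ) → Γ ⨾ Δ ⊢ A [ t ]
  conv  : ∀ {Γ Δ A C} → A ≈F C → Γ ⨾ Δ ⊢ A → Γ ⨾ Δ ⊢ C
  truth : ∀ {Γ Δ} → Γ ⨾ Δ ⊢ at true
  stab  : ∀ {Γ Δ} (A : Fm Γ) → Γ ⨾ Δ ⊢ ¬F (¬F A) ⊃ A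
  indB  : ∀ {Γ Δ} (A : Fm (B ∷ Γ)) →
          Γ ⨾ Δ ⊢ A [ true ] ⊃ A [ false ] ⊃ ∀' B A
  indN  : ∀ {Γ Δ} (A : Fm (N ∷ Γ)) →
          Γ ⨾ Δ ⊢ A [ zero ] ⊃ ∀' N (A ⊃ subF succSub A) ⊃ ∀' N A
  compat : ∀ {Γ Δ ρ} (A : Fm (ρ ∷ Γ)) (s t : Tm Γ ρ) →
          Γ ⨾ Δ ⊢ Eq ρ s t ⊃ A [ s ] ⊃ A [ t ]

infixr 5 _⊃ₘ_
infixr 6 _∧ₘ_
data MFm (Γ : Ctx) : Set where
  mat   : Tm Γ B → MFm Γ
  _⊃ₘ_  : MFm Γ → MFm Γ → MFm Γ
  _∧ₘ_  : MFm Γ → MFm Γ → MFm Γ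
  ∀ₘ    : (ρ : Ty) → MFm (ρ ∷ Γ) → MFm Γ
  □     : MFm Γ → MFm Γ
  ∀⁺    : (ρ : Ty) → MFm (ρ ∷ Γ) → MFm Γ
  ∀⁻    : (ρ : Ty) → MFm (ρ ∷ Γ) → MFm Γ
  ∀ⁿᶜ   : (ρ : Ty) → MFm (ρ ∷ Γ) → MFm Γ

-- formulas of the (non-light) modal language
IsModal : ∀ {Γ} → MFm Γ → Set
IsModal (mat t)   = ⊤
IsModal (A ⊃ₘ C)  = IsModal A × IsModal C
IsModal (A ∧ₘ C)  = IsModal A × IsModal C
IsModal (∀ₘ ρ A)  = IsModal A
IsModal (□ A)     = IsModal A
IsModal (∀⁺ ρ A)  = ⊥
IsModal (∀⁻ ρ A)  = ⊥
IsModal (∀ⁿᶜ ρ A) = ⊥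

⊥ₘ : ∀ {Γ} → MFm Γ
⊥ₘ = mat false

¬ₘ : ∀ {Γ} → MFm Γ → MFm Γ
¬ₘ A = A ⊃ₘ ⊥ₘ

◇ : ∀ {Γ} → MFm Γ → MFm Γ
◇ A = ¬ₘ (□ (¬ₘ A))

axiom5 : ∀ {Γ} → MFm Γ → MFm Γ
axiom5 A = ◇ A ⊃ₘ □ (◇ A)

_⇒*_ : List Ty → Ty → Ty
[]       ⇒* τ = τ
(ρ ∷ ρs) ⇒* τ = ρ ⇒ (ρs ⇒* τ)

-- types of witness tuples and challenge tuples
W C : ∀ {Γ} → MFm Γ → List Ty
W (mat t)   = []
W (A ⊃ₘ D)  = map (λ c → W A ⇒* (C D ⇒* c)) (C A) ++ map (λ w → W A ⇒* w) (W D)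
W (A ∧ₘ D)  = W A ++ W D
W (∀ₘ ρ A)  = map (ρ ⇒_) (W A)
W (□ A)     = W A
W (∀⁺ ρ A)  = map (ρ ⇒_) (W A)
W (∀⁻ ρ A)  = W A
W (∀ⁿᶜ ρ A) = W A
C (mat t)   = []
C (A ⊃ₘ D)  = W A ++ C D
C (A ∧ₘ D)  = C A ++ C D
C (∀ₘ ρ A)  = ρ ∷ C A
C (□ A)     = []
C (∀⁺ ρ A)  = C A
C (∀⁻ ρ A)  = ρ ∷ C A
C (∀ⁿᶜ ρ A) = C A

Tms : Ctx → List Ty → Set
Tms Δ = All (Tm Δ)

renTms : ∀ {Γ Δ ρs} → Ren Γ Δ → Tms Γ ρs → Tms Δ ρs
renTms r []       = []
renTms r (t ∷ ts) = ren r t ∷ renTms r ts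

split : ∀ {Δ} (as : List Ty) {bs : List Ty} → Tms Δ (as ++ bs) → Tms Δ as × Tms Δ bs
split []       ts       = [] , ts
split (a ∷ as) (t ∷ ts) with split as ts
... | xs , ys = (t ∷ xs) , ys

appMany : ∀ {Δ τ} {ρs : List Ty} → Tm Δ (ρs ⇒* τ) → Tms Δ ρs → Tm Δ τ
appMany f []       = f
appMany f (t ∷ ts) = appMany (f · t) ts

app1 : ∀ {Δ} (as ws : List Ty) → Tms Δ (map (λ w → as ⇒* w) ws) → Tms Δ as → Tms Δ ws
app1 as []       []       xs = []
app1 as (w ∷ ws) (f ∷ fs) xs = appMany f xs ∷ app1 as ws fs xs

app2 : ∀ {Δ} (as bs cs : List Ty) → Tms Δ (map (λ c → as ⇒* (bs ⇒* c)) cs) →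
       Tms Δ as → Tms Δ bs → Tms Δ cs
app2 as bs []       []       xs ys = []
app2 as bs (c ∷ cs) (f ∷ fs) xs ys = appMany (appMany f xs) ys ∷ app2 as bs cs fs xs ys

appEach : ∀ {Δ ρ} (ws : List Ty) → Tms Δ (map (ρ ⇒_) ws) → Tm Δ ρ → Tms Δ ws
appEach []       []       z = []
appEach (w ∷ ws) (f ∷ fs) z = (f · z) ∷ appEach ws fs z

-- ∀ y₁ … ∀ yₙ  B(y₁,…,yₙ)  (B given Kripke-style, over any extension of Δ)
allMany : ∀ {Δ} (ρs : List Ty) → (∀ {Δ′} → Ren Δ Δ′ → Tms Δ′ ρs → Fm Δ′) → Fm Δ
allMany []       k = k id []
allMany (ρ ∷ ρs) k = ∀' ρ (allMany ρs (λ r ys → k (r ∘ there) (var (r here) ∷ ys)))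

-- |A|^x_y, where the free variables of A are instantiated by the substitution σ
dial : ∀ {Γ Δ} (A : MFm Γ) → Sub Γ Δ → Tms Δ (W A) → Tms Δ (C A) → Fm Δ
dial (mat t)   σ x y = at (sub σ t)
dial (A ⊃ₘ D)  σ fg xv with split (map (λ c → W A ⇒* (C D ⇒* c)) (C A)) fg | split (W A) xv
... | f , g | x , v = dial A σ x (app2 (W A) (C D) (C A) f x v)
                      ⊃ dial D σ (app1 (W A) (W D) g x) v
dial (A ∧ₘ D)  σ xu yv with split (W A) xu | split (C A) yv
... | x , u | y , v = dial A σ x y ∧ dial D σ u v
dial (∀ₘ ρ A)  σ f (z ∷ y) = dial A (σ ,ₛ z) (appEach (W A) f z) y
dial (□ A)     σ x y = allMany (C A) (λ r ys → dial A (ren r ∘ σ) (renTms r x) ys)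
dial (∀⁺ ρ A)  σ f y = ∀' ρ (dial A (extS σ) (appEach (W A) (renTms there f) (var here)) (renTms there y))
dial (∀⁻ ρ A)  σ x (z ∷ y) = dial A (σ ,ₛ z) x y
dial (∀ⁿᶜ ρ A) σ x y = ∀' ρ (dial A (extS σ) (renTms there x) (renTms there y))

-- C (with free variables among Γ) is realizable in V^ω:
-- terms t in Γ with  V^ω ⊢ ∀y |C|^t_y
Realizable : ∀ {Γ} → MFm Γ → Set
Realizable {Γ} A =
  Σ (Tms Γ (W A)) λ t → Γ ⨾ [] ⊢ allMany (C A) (λ r ys → dial A (var ∘ r) (renTms r t) ys)

-- A realizer of ◇A → □◇A for A :≡ ∀n at(g n), with g : N → B free, is a
-- term t[g] : N such that V^ω ⊢ ¬¬at(g t[g]) → ∀k ¬¬at(g k). V^ω, its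
-- extensionality axiom included, is sound for the hereditarily extensional
-- set-theoretic model of the finite types, where this says that g(t[g]) = true
-- forces g to be constantly true. But every System T functional is continuous
-- on Cantor space: if t[λi.true] = k and t reads its argument only below M,
-- then the g that is true exactly below M + k + 1 has g(t[g]) = g(k) = true
-- without being constantly true.
module Submission where

open import Defs
open import Data.Bool using (Bool; true; false; if_then_else_)
open import Data.List using (List; []; _∷_; map)
open import Data.List.Relation.Unary.All using (All; []; _∷_; lookup; head)
open import Data.Nat using (ℕ; zero; suc; _+_; _⊔_; _≤_; _<_; s≤s)
open import Data.Nat.Properties using (m≤m⊔n; m≤n⊔m; <-≤-trans; n<1+n; m≤m+n; m≤n+m)
open import Data.Product using (Σ; _×_; _,_; proj₁; proj₂)
open import Data.Unit using (tt)
open import Function using (_∘_; _$_; id)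
open import Function.Bundles using (_⇔_; mk⇔; Equivalence)
open import Relation.Binary.PropositionalEquality using (_≡_; _≢_; refl; sym; trans; cong)
open import Relation.Nullary using (¬_)

open Equivalence using (to; from)

private variable
  Γ Δ : Ctx
  ρ σ : Ty

-- The set-theoretic model of the finite types

⟦_⟧ : Ty → Set
⟦ N ⟧     = ℕ
⟦ B ⟧     = Bool
⟦ ρ ⇒ σ ⟧ = ⟦ ρ ⟧ → ⟦ σ ⟧

Env : Ctx → Set
Env Γ = ∀ {ρ} → Γ ∋ ρ → ⟦ ρ ⟧

infixr 5 _∷ₑ_
_∷ₑ_ : ⟦ ρ ⟧ → Env Γ → Env (ρ ∷ Γ)
(a ∷ₑ γ) here      = a
(a ∷ₑ γ) (there x) = γ x

natrec : {X : Set} → ℕ → X → (ℕ → X → X) → X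
natrec zero    r s = r
natrec (suc n) r s = s n (natrec n r s)

eval : Tm Γ ρ → Env Γ → ⟦ ρ ⟧
eval (var x) γ = γ x
eval true    γ = true
eval false   γ = false
eval zero    γ = zero
eval S       γ = suc
eval If      γ = λ b x y → if b then x else y
eval Rec     γ = natrec
eval (lam t) γ = λ a → eval t (a ∷ₑ γ)
eval (t · u) γ = eval t γ (eval u γ)

evalₛ : Sub Γ Δ → Env Δ → Env Γ
evalₛ s γ x = eval (s x) γ

-- The model consists of the elements
-- related to themselves; arbitrary Agda functionals need not respect
-- pointwise equality of their arguments, as the compatibility axiom demands.
infix 4 _~_
_~_ : ⟦ ρ ⟧ → ⟦ ρ ⟧ → Set
_~_ {N}     a b = a ≡ b
_~_ {B}     a b = a ≡ b
_~_ {ρ ⇒ σ} f g = ∀ {a b} → a ~ b → f a ~ g b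

~-sym : ∀ {ρ} {a b : ⟦ ρ ⟧} → a ~ b → b ~ a
~-sym {N}     p   = sym p
~-sym {B}     p   = sym p
~-sym {ρ ⇒ σ} p q = ~-sym {σ} (p (~-sym {ρ} q))

~-trans : ∀ {ρ} {a b c : ⟦ ρ ⟧} → a ~ b → b ~ c → a ~ c
~-trans {N}     p q   = trans p q
~-trans {B}     p q   = trans p q
~-trans {ρ ⇒ σ} p q r = ~-trans {σ} (p r) (q (~-trans {ρ} (~-sym {ρ} r) r))

~-reflˡ : ∀ {ρ} {a b : ⟦ ρ ⟧} → a ~ b → a ~ a
~-reflˡ {ρ} p = ~-trans {ρ} p (~-sym {ρ} p)

infix 4 _~ₑ_
_~ₑ_ : Env Γ → Env Γ → Set
_~ₑ_ {Γ} γ δ = ∀ {ρ} (x : Γ ∋ ρ) → γ x ~ δ x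

~ₑ-sym : {γ δ : Env Γ} → γ ~ₑ δ → δ ~ₑ γ
~ₑ-sym p {ρ} x = ~-sym {ρ} (p x)

~ₑ-reflˡ : {γ δ : Env Γ} → γ ~ₑ δ → γ ~ₑ γ
~ₑ-reflˡ p {ρ} x = ~-reflˡ {ρ} (p x)

~ₑ-∷ : {γ δ : Env Γ} {a b : ⟦ ρ ⟧} → a ~ b → γ ~ₑ δ → (a ∷ₑ γ) ~ₑ (b ∷ₑ δ)
~ₑ-∷ p q here      = p
~ₑ-∷ p q (there x) = q x

if-resp-~ : _~_ {B ⇒ ρ ⇒ ρ ⇒ ρ} (λ b x y → if b then x else y) (λ b x y → if b then x else y)
if-resp-~ {a = true}  refl p q = p
if-resp-~ {a = false} refl p q = q

natrec-resp-~ : _~_ {N ⇒ ρ ⇒ (N ⇒ ρ ⇒ ρ) ⇒ ρ} natrec natrec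
natrec-resp-~ {a = zero}  refl p q = p
natrec-resp-~ {ρ} {a = suc n} refl p q = q refl (natrec-resp-~ {ρ} {a = n} refl p q)

eval-resp-~ : (t : Tm Γ ρ) {γ δ : Env Γ} → γ ~ₑ δ → eval t γ ~ eval t δ
eval-resp-~ (var x)   p   = p x
eval-resp-~ true      p   = refl
eval-resp-~ false     p   = refl
eval-resp-~ zero      p   = refl
eval-resp-~ S         p q = cong suc q
eval-resp-~ (If {ρ})  p   = if-resp-~ {ρ}
eval-resp-~ (Rec {ρ}) p   = natrec-resp-~ {ρ}
eval-resp-~ (lam t)   p q = eval-resp-~ t (~ₑ-∷ q p)
eval-resp-~ (t · u)   p   = eval-resp-~ t p (eval-resp-~ u p)

eval-ren : (t : Tm Γ ρ) (r : Ren Γ Δ) {γ : Env Δ} {δ : Env Γ} →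
           (∀ {σ} (x : Γ ∋ σ) → γ (r x) ~ δ x) → eval (ren r t) γ ~ eval t δ
eval-ren (var x)   r p   = p x
eval-ren true      r p   = refl
eval-ren false     r p   = refl
eval-ren zero      r p   = refl
eval-ren S         r p q = cong suc q
eval-ren (If {ρ})  r p   = if-resp-~ {ρ}
eval-ren (Rec {ρ}) r p   = natrec-resp-~ {ρ}
eval-ren (lam t)   r p q = eval-ren t (extR r) λ { here → q ; (there x) → p x }
eval-ren (t · u)   r p   = eval-ren t r p (eval-ren u r p)

eval-wk : (t : Tm Γ ρ) {γ : Env Γ} (a : ⟦ σ ⟧) → γ ~ₑ γ → eval (wk t) (a ∷ₑ γ) ~ eval t γ
eval-wk t a p = eval-ren t there p

evalₛ-extS : (s : Sub Γ Δ) {γ : Env Δ} {δ : Env Γ} {a b : ⟦ ρ ⟧} → γ ~ₑ γ →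
             evalₛ s γ ~ₑ δ → a ~ b → evalₛ (extS s) (a ∷ₑ γ) ~ₑ (b ∷ₑ δ)
evalₛ-extS s hγ p q here          = q
evalₛ-extS s hγ p q {σ} (there x) = ~-trans {σ} (eval-wk (s x) _ hγ) (p x)

eval-sub : (t : Tm Γ ρ) (s : Sub Γ Δ) {γ : Env Δ} {δ : Env Γ} → γ ~ₑ γ →
           evalₛ s γ ~ₑ δ → eval (sub s t) γ ~ eval t δ
eval-sub (var x)       s hγ p   = p x
eval-sub true          s hγ p   = refl
eval-sub false         s hγ p   = refl
eval-sub zero          s hγ p   = refl
eval-sub S             s hγ p q = cong suc q
eval-sub (If {ρ})      s hγ p   = if-resp-~ {ρ}
eval-sub (Rec {ρ})     s hγ p   = natrec-resp-~ {ρ}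
eval-sub (lam {ρ} t)   s hγ p q =
  eval-sub t (extS s) (~ₑ-∷ (~-reflˡ {ρ} q) hγ) (evalₛ-extS s hγ p q)
eval-sub (t · u)       s hγ p   = eval-sub t s hγ p (eval-sub u s hγ p)

evalₛ-sub0 : (t : Tm Γ ρ) {γ : Env Γ} → γ ~ₑ γ → evalₛ (sub0 t) γ ~ₑ (eval t γ ∷ₑ γ)
evalₛ-sub0 t hγ here      = eval-resp-~ t hγ
evalₛ-sub0 t hγ (there x) = hγ x

eval-resp-≈ : {s t : Tm Γ ρ} → s ≈ t → {γ δ : Env Γ} → γ ~ₑ δ → eval s γ ~ eval t δ
eval-resp-≈ {t = t}  ≈refl          p   = eval-resp-~ t p
eval-resp-≈ {ρ = ρ}  (≈sym e)       p   = ~-sym {ρ} (eval-resp-≈ e (~ₑ-sym p))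
eval-resp-≈ {ρ = ρ}  (≈trans e f)   p   = ~-trans {ρ} (eval-resp-≈ e (~ₑ-reflˡ p)) (eval-resp-≈ f p)
eval-resp-≈          (≈app e f)     p   = eval-resp-≈ e p (eval-resp-≈ f p)
eval-resp-≈          (≈lam e)       p q = eval-resp-≈ e (~ₑ-∷ q p)
eval-resp-≈          (≈β {σ = σ} r s) p =
  ~-trans {σ} (eval-resp-~ r (~ₑ-∷ (eval-resp-~ s p) p))
              (~-sym {σ} (eval-sub r (sub0 s) hδ (evalₛ-sub0 s hδ)))
  where hδ = ~ₑ-reflˡ (~ₑ-sym p)
eval-resp-≈          (≈η {ρ} {σ} t) p q =
  ~-trans {σ} (eval-wk t _ (~ₑ-reflˡ p) (~-reflˡ {ρ} q)) (eval-resp-~ t p q)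
eval-resp-≈          (≈ifT r s)     p   = eval-resp-~ r p
eval-resp-≈          (≈ifF r s)     p   = eval-resp-~ s p
eval-resp-≈          (≈rec0 r s)    p   = eval-resp-~ r p
eval-resp-≈          (≈recS n r s)  p   = eval-resp-~ (s · n · (Rec · n · r · s)) p

⟦_⟧F : Fm Γ → Env Γ → Set
⟦ at t ⟧F    γ = eval t γ ≡ true
⟦ A ⊃ D ⟧F   γ = ⟦ A ⟧F γ → ⟦ D ⟧F γ
⟦ A ∧ D ⟧F   γ = ⟦ A ⟧F γ × ⟦ D ⟧F γ
⟦ ∀' ρ A ⟧F γ = (a : ⟦ ρ ⟧) → a ~ a → ⟦ A ⟧F (a ∷ₑ γ)

⟦⟧F-resp-~ : (A : Fm Γ) {γ δ : Env Γ} → γ ~ₑ δ → ⟦ A ⟧F γ → ⟦ A ⟧F δ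
⟦⟧F-resp-~ (at t)   p h       = trans (sym (eval-resp-~ t p)) h
⟦⟧F-resp-~ (A ⊃ D)  p h x     = ⟦⟧F-resp-~ D p (h (⟦⟧F-resp-~ A (~ₑ-sym p) x))
⟦⟧F-resp-~ (A ∧ D)  p (x , y) = ⟦⟧F-resp-~ A p x , ⟦⟧F-resp-~ D p y
⟦⟧F-resp-~ (∀' ρ A) p h a ha  = ⟦⟧F-resp-~ A (~ₑ-∷ ha p) (h a ha)

⟦subF⟧ : (A : Fm Γ) (s : Sub Γ Δ) {γ : Env Δ} {δ : Env Γ} → γ ~ₑ γ →
         evalₛ s γ ~ₑ δ → ⟦ subF s A ⟧F γ ⇔ ⟦ A ⟧F δ
⟦subF⟧ (at t) s hγ p =
  mk⇔ (trans (sym (eval-sub t s hγ p))) (trans (eval-sub t s hγ p))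
⟦subF⟧ (A ⊃ D) s hγ p =
  mk⇔ (λ h x → to (⟦subF⟧ D s hγ p) (h (from (⟦subF⟧ A s hγ p) x)))
      (λ h x → from (⟦subF⟧ D s hγ p) (h (to (⟦subF⟧ A s hγ p) x)))
⟦subF⟧ (A ∧ D) s hγ p =
  mk⇔ (λ (x , y) → to (⟦subF⟧ A s hγ p) x , to (⟦subF⟧ D s hγ p) y)
      (λ (x , y) → from (⟦subF⟧ A s hγ p) x , from (⟦subF⟧ D s hγ p) y)
⟦subF⟧ (∀' ρ A) s hγ p =
  mk⇔ (λ h a ha → to (under a ha) (h a ha)) (λ h a ha → from (under a ha) (h a ha))
  where
  under : (a : ⟦ ρ ⟧) → a ~ a → ⟦ subF (extS s) A ⟧F (a ∷ₑ _) ⇔ ⟦ A ⟧F (a ∷ₑ _)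
  under a ha = ⟦subF⟧ A (extS s) (~ₑ-∷ ha hγ) (evalₛ-extS s hγ p ha)

⟦[]⟧ : (A : Fm (ρ ∷ Γ)) (t : Tm Γ ρ) {γ : Env Γ} → γ ~ₑ γ →
       ⟦ A [ t ] ⟧F γ ⇔ ⟦ A ⟧F (eval t γ ∷ₑ γ)
⟦[]⟧ A t hγ = ⟦subF⟧ A (sub0 t) hγ (evalₛ-sub0 t hγ)

≈F-sym : {A D : Fm Γ} → A ≈F D → D ≈F A
≈F-sym (at≈ e)  = at≈ (≈sym e)
≈F-sym (⊃≈ e f) = ⊃≈ (≈F-sym e) (≈F-sym f)
≈F-sym (∧≈ e f) = ∧≈ (≈F-sym e) (≈F-sym f)
≈F-sym (∀≈ e)   = ∀≈ (≈F-sym e)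

⟦⟧F-resp-≈F : {A D : Fm Γ} → A ≈F D → {γ δ : Env Γ} → γ ~ₑ δ → ⟦ A ⟧F γ → ⟦ D ⟧F δ
⟦⟧F-resp-≈F (at≈ e)  p h       = trans (sym (eval-resp-≈ e p)) h
⟦⟧F-resp-≈F (⊃≈ e f) p h x     = ⟦⟧F-resp-≈F f p (h (⟦⟧F-resp-≈F (≈F-sym e) (~ₑ-sym p) x))
⟦⟧F-resp-≈F (∧≈ e f) p (x , y) = ⟦⟧F-resp-≈F e p x , ⟦⟧F-resp-≈F f p y
⟦⟧F-resp-≈F (∀≈ e)   p h a ha  = ⟦⟧F-resp-≈F e (~ₑ-∷ ha p) (h a ha)

⟦⟧F-stable : (A : Fm Γ) (γ : Env Γ) → ⟦ ¬F (¬F A) ⟧F γ → ⟦ A ⟧F γ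
⟦⟧F-stable (at t) γ h with eval t γ
... | true  = refl
... | false = h λ ()
⟦⟧F-stable (A ⊃ D)  γ h x    = ⟦⟧F-stable D γ λ k → h λ f → k (f x)
⟦⟧F-stable (A ∧ D)  γ h      = ⟦⟧F-stable A γ (λ k → h (k ∘ proj₁))
                             , ⟦⟧F-stable D γ (λ k → h (k ∘ proj₂))
⟦⟧F-stable (∀' ρ A) γ h a ha = ⟦⟧F-stable A (a ∷ₑ γ) λ k → h λ f → k (f a ha)

eqN-sound : (γ : Env Γ) (a b : ℕ) → eval eqN γ a b ≡ true → a ≡ b
eqN-sound γ zero    zero    e = refl
eqN-sound γ (suc a) (suc b) e = cong suc (eqN-sound γ a b e)

eqB-sound : (γ : Env Γ) (a b : Bool) → eval eqB γ a b ≡ true → a ≡ b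
eqB-sound γ true  true  e = refl
eqB-sound γ false false e = refl

⟦Eq⟧⇒~ : (ρ : Ty) (s t : Tm Γ ρ) {γ : Env Γ} → γ ~ₑ γ → ⟦ Eq ρ s t ⟧F γ → eval s γ ~ eval t γ
⟦Eq⟧⇒~ N s t {γ} hγ h = eqN-sound γ (eval s γ) (eval t γ) h
⟦Eq⟧⇒~ B s t {γ} hγ h = eqB-sound γ (eval s γ) (eval t γ) h
⟦Eq⟧⇒~ (ρ ⇒ σ) s t hγ h {a} q =
  ~-trans {σ} (~-sym {σ} (eval-wk s a hγ ha))
    (~-trans {σ} (⟦Eq⟧⇒~ σ (wk s · var here) (wk t · var here) (~ₑ-∷ ha hγ) (h a ha))
      (~-trans {σ} (eval-wk t a hγ ha) (eval-resp-~ t hγ q)))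
  where ha = ~-reflˡ {ρ} q

soundness : {Δ : List (Fm Γ)} {A : Fm Γ} → Γ ⨾ Δ ⊢ A →
            (γ : Env Γ) → γ ~ₑ γ → All (λ D → ⟦ D ⟧F γ) Δ → ⟦ A ⟧F γ
soundness (hyp x)  γ hγ hΔ = lookup hΔ x
soundness (⊃I d)   γ hγ hΔ x = soundness d γ hγ (x ∷ hΔ)
soundness (⊃E d e) γ hγ hΔ = soundness d γ hγ hΔ (soundness e γ hγ hΔ)
soundness (∧I d e) γ hγ hΔ = soundness d γ hγ hΔ , soundness e γ hγ hΔ
soundness (∧E₁ d)  γ hγ hΔ = proj₁ (soundness d γ hγ hΔ)
soundness (∧E₂ d)  γ hγ hΔ = proj₂ (soundness d γ hγ hΔ)
soundness {Δ = Δ} (∀I d) γ hγ hΔ a ha = soundness d (a ∷ₑ γ) (~ₑ-∷ ha hγ) (wkAll Δ hΔ)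
  where
  wkAll : ∀ Δ′ → All (λ D → ⟦ D ⟧F γ) Δ′ → All (λ D → ⟦ D ⟧F (a ∷ₑ γ)) (map wkF Δ′)
  wkAll []       []       = []
  wkAll (D ∷ Δ′) (x ∷ xs) = from (⟦subF⟧ D (var ∘ there) (~ₑ-∷ ha hγ) hγ) x ∷ wkAll Δ′ xs
soundness (∀E {A = A} d t) γ hγ hΔ =
  from (⟦[]⟧ A t hγ) (soundness d γ hγ hΔ (eval t γ) (eval-resp-~ t hγ))
soundness (conv e d) γ hγ hΔ = ⟦⟧F-resp-≈F e hγ (soundness d γ hγ hΔ)
soundness truth      γ hγ hΔ = refl
soundness (stab A)   γ hγ hΔ = ⟦⟧F-stable A γ
soundness (indB A)   γ hγ hΔ ht hf true  _ = to (⟦[]⟧ A true hγ) ht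
soundness (indB A)   γ hγ hΔ ht hf false _ = to (⟦[]⟧ A false hγ) hf
soundness (indN A)   γ hγ hΔ h0 hs n _ = induction n
  where
  induction : ∀ n → ⟦ A ⟧F (n ∷ₑ γ)
  induction zero    = to (⟦[]⟧ A zero hγ) h0
  induction (suc n) = to (⟦subF⟧ A succSub (~ₑ-∷ refl hγ) λ { here → refl ; (there x) → hγ x })
                         (hs n refl (induction n))
soundness (compat {ρ = ρ} A s t) γ hγ hΔ s≐t hs =
  from (⟦[]⟧ A t hγ) (⟦⟧F-resp-~ A (~ₑ-∷ (⟦Eq⟧⇒~ ρ s t hγ s≐t) hγ) (to (⟦[]⟧ A s hγ) hs))

-- Continuity of System T functionals on Cantor space

Seq : Set
Seq = ℕ → Bool

_≡[<_]_ : Seq → ℕ → Seq → Set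
g ≡[< M ] g′ = ∀ i → i < M → g i ≡ g′ i

≡[<]-mono : ∀ {M M′} {g g′ : Seq} → M ≤ M′ → g ≡[< M′ ] g′ → g ≡[< M ] g′
≡[<]-mono M≤M′ g≡g′ i i<M = g≡g′ i (<-≤-trans i<M M≤M′)

LocallyConstant : {X : Set} → (Seq → X) → Set
LocallyConstant v = ∀ g → Σ ℕ λ M → ∀ g′ → g ≡[< M ] g′ → v g′ ≡ v g

LocallyConstant-const : {X : Set} (x : X) → LocallyConstant (λ _ → x)
LocallyConstant-const x g = 0 , λ _ _ → refl

Continuous : ∀ ρ → (Seq → ⟦ ρ ⟧) → Set
Continuous N       = LocallyConstant
Continuous B       = LocallyConstant
Continuous (ρ ⇒ σ) f = ∀ v → Continuous ρ v → Continuous σ (λ g → f g (v g))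

LocallyConstant-case : {X Y : Set} (b : Seq → X) → LocallyConstant b →
                       (h : X → Seq → Y) → (∀ k → LocallyConstant (h k)) →
                       LocallyConstant (λ g → h (b g) g)
LocallyConstant-case b b-lc h h-lc g with b-lc g | h-lc (b g) g
... | M₀ , p₀ | M₁ , p₁ = M₀ ⊔ M₁ , λ g′ g≡g′ →
  trans (cong (λ k → h k g′) (p₀ g′ (≡[<]-mono (m≤m⊔n M₀ M₁) g≡g′)))
        (p₁ g′ (≡[<]-mono (m≤n⊔m M₀ M₁) g≡g′))

Continuous-case : ∀ ρ {X : Set} (b : Seq → X) → LocallyConstant b →
                  (h : X → Seq → ⟦ ρ ⟧) → (∀ k → Continuous ρ (h k)) →
                  Continuous ρ (λ g → h (b g) g)
Continuous-case N       = LocallyConstant-case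
Continuous-case B       = LocallyConstant-case
Continuous-case (ρ ⇒ σ) b b-lc h h-cont v v-cont =
  Continuous-case σ b b-lc (λ k g → h k g (v g)) (λ k → h-cont k v v-cont)

Continuous-natrec : ∀ ρ (r : Seq → ⟦ ρ ⟧) (s : Seq → ⟦ N ⇒ ρ ⇒ ρ ⟧) →
                    Continuous ρ r → Continuous (N ⇒ ρ ⇒ ρ) s →
                    ∀ k → Continuous ρ (λ g → natrec k (r g) (s g))
Continuous-natrec ρ r s r-cont s-cont zero    = r-cont
Continuous-natrec ρ r s r-cont s-cont (suc k) =
  s-cont (λ _ → k) (LocallyConstant-const k) _ (Continuous-natrec ρ r s r-cont s-cont k)

ContinuousEnv : (Seq → Env Γ) → Set
ContinuousEnv {Γ} γ = ∀ {ρ} (x : Γ ∋ ρ) → Continuous ρ (λ g → γ g x)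

eval-continuous : (t : Tm Γ ρ) (γ : Seq → Env Γ) → ContinuousEnv γ →
                  Continuous ρ (λ g → eval t (γ g))
eval-continuous (var x)   γ γ-cont = γ-cont x
eval-continuous true      γ γ-cont = LocallyConstant-const true
eval-continuous false     γ γ-cont = LocallyConstant-const false
eval-continuous zero      γ γ-cont = LocallyConstant-const zero
eval-continuous S         γ γ-cont v v-lc g with v-lc g
... | M , p = M , λ g′ g≡g′ → cong suc (p g′ g≡g′)
eval-continuous (If {ρ})  γ γ-cont b b-lc x x-cont y y-cont =
  Continuous-case ρ b b-lc (λ k g → if k then x g else y g) λ { true → x-cont ; false → y-cont }
eval-continuous (Rec {ρ}) γ γ-cont n n-lc r r-cont s s-cont =
  Continuous-case ρ n n-lc (λ k g → natrec k (r g) (s g)) (Continuous-natrec ρ r s r-cont s-cont)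
eval-continuous (lam t)   γ γ-cont v v-cont =
  eval-continuous t (λ g → v g ∷ₑ γ g) λ { here → v-cont ; (there x) → γ-cont x }
eval-continuous (t · u)   γ γ-cont =
  eval-continuous t γ γ-cont _ (eval-continuous u γ γ-cont)

Continuous-id : Continuous (N ⇒ B) id
Continuous-id v v-lc g with v-lc g
... | M , p = M ⊔ suc (v g) , λ g′ g≡g′ →
  trans (cong g′ (p g′ (≡[<]-mono (m≤m⊔n M (suc (v g))) g≡g′)))
        (sym (g≡g′ (v g) (<-≤-trans (n<1+n (v g)) (m≤n⊔m M (suc (v g))))))

-- The counterexample

Γ₀ : Ctx
Γ₀ = (N ⇒ B) ∷ []

everywhereTrue : MFm Γ₀
everywhereTrue = ∀ₘ N (mat (var (there here) · var here))

envOf : Seq → Env Γ₀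
envOf g here = g

envOf-~ : (g : Seq) → envOf g ~ₑ envOf g
envOf-~ g here = cong g

ContinuousEnv-envOf : ContinuousEnv envOf
ContinuousEnv-envOf here = Continuous-id

realizer-sound : (R : Realizable (axiom5 everywhereTrue)) (g : Seq) →
                 g (eval (head (proj₁ R)) (envOf g)) ≡ true → ∀ K → g K ≢ false
realizer-sound (n ∷ [] , d) g gn≡true K gK≡false = false≢true $
  soundness d (envOf g) (envOf-~ g) [] (λ ¬gn → ¬gn gn′≡true) K refl
    (λ gK≡true → trans (sym gK≡false) gK≡true)
  where
  gn′≡true : g (eval (ren id (ren id n)) (envOf g)) ≡ true
  gn′≡true = trans (cong g (trans (eval-ren (ren id n) id (envOf-~ g))
                                  (eval-ren n id (envOf-~ g))))
                   gn≡true
  false≢true : false ≢ true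
  false≢true ()

trueBelow : ℕ → Seq
trueBelow zero    i       = false
trueBelow (suc K) zero    = true
trueBelow (suc K) (suc i) = trueBelow K i

trueBelow-< : ∀ {K i} → i < K → trueBelow K i ≡ true
trueBelow-< {suc K} {zero}  _         = refl
trueBelow-< {suc K} {suc i} (s≤s i<K) = trueBelow-< i<K

trueBelow-self : ∀ K → trueBelow K K ≡ false
trueBelow-self zero    = refl
trueBelow-self (suc K) = trueBelow-self K

axiom5-everywhereTrue-unrealizable : ¬ Realizable (axiom5 everywhereTrue)
axiom5-everywhereTrue-unrealizable R@(n ∷ [] , _)
  with eval-continuous n envOf ContinuousEnv-envOf (λ _ → true)
... | M , n-lc = realizer-sound R g g[n[g]] K (trueBelow-self K)
  where
  k = eval n (envOf (λ _ → true))
  K = M + suc k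
  g = trueBelow K
  n[g]≡k : eval n (envOf g) ≡ k
  n[g]≡k = n-lc g λ i i<M → sym (trueBelow-< (<-≤-trans i<M (m≤m+n M (suc k))))
  g[n[g]] : g (eval n (envOf g)) ≡ true
  g[n[g]] = trans (cong g n[g]≡k) (trueBelow-< (m≤n+m (suc k) M))

mainTheorem2 : (Σ Ctx λ Γ → Σ (MFm Γ) λ A → IsModal A × ¬ Realizable (axiom5 A))
    × (Σ Ctx λ Γ → Σ (MFm Γ) λ A → ¬ Realizable (axiom5 A))
mainTheorem2 = (Γ₀ , everywhereTrue , tt , axiom5-everywhereTrue-unrealizable)
             , (Γ₀ , everywhereTrue , axiom5-everywhereTrue-unrealizable)
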